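{- Let $\ell\ge 3$ be an odd integer and let $m=\lfloor \sqrt{\ell}+\tfrac{7}{2}\rfloor$. For every integer $k\ge 1$ and $n=(\ell+1)^k$, there is a completely balanced edge-coloring of $K_n$ with $\ell$ colors containing no rainbow $K_m$.
   Context: $K_n$ denotes the complete graph on $n$ vertices. An edge-coloring of $K_n$ using a set $C$ of $\ell$ colors, where $\ell$ divides $n-1$, is completely balanced if every vertex is incident to exactly $(n-1)/\ell$ edges of each color of $C$. A subgraph is rainbow if all its edges receive distinct colors. -}

module Defs where

open import Data.Nat using (ℕ; zero; suc; _+_; _*_; _∸_; _^_; _≤_; _<_)
open import Data.Nat.Divisibility using (_∣_)
open import Data.Fin using (Fin; _<_)
open import Data.Fin.Subset using (Subset; ∣_∣)
open import Data.Vec using (tabulate)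
open import Data.Bool using (Bool; true; false)
open import Data.Product using (_×_; Σ)
open import Relation.Nullary using (¬_; does)
open import Relation.Binary.PropositionalEquality using (_≡_; _≢_)
import Data.Fin as F

-- An edge-colouring of K_n with colour set Fin ℓ: a symmetric function on
-- ordered pairs of vertices; the value on the diagonal (u , u) is irrelevant.
record EdgeColoring (n ℓ : ℕ) : Set where
  field
    col : Fin n → Fin n → Fin ℓ
    sym : ∀ u v → col u v ≡ col v u
open EdgeColoring public

colourNbhd : ∀ {n ℓ} → EdgeColoring n ℓ → Fin n → Fin ℓ → Subset n
colourNbhd c v a = tabulate λ u → sel (does (v F.≟ u)) (does (col c v u F.≟ a))
  where
  sel : Bool → Bool → Bool
  sel true  _ = false
  sel false b = b

colourDeg : ∀ {n ℓ} → EdgeColoring n ℓ → Fin n → Fin ℓ → ℕ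
colourDeg c v a = ∣ colourNbhd c v a ∣

-- Completely balanced: ℓ divides n - 1 and every vertex is incident to exactly
-- (n-1)/ℓ edges of each colour (stated as deg * ℓ ≡ n - 1).
CompletelyBalanced : ∀ {n ℓ} → EdgeColoring n ℓ → Set
CompletelyBalanced {n} {ℓ} c =
  (ℓ ∣ (n ∸ 1)) × (∀ v a → colourDeg c v a * ℓ ≡ n ∸ 1)

RainbowClique : ∀ {n ℓ} → EdgeColoring n ℓ → (m : ℕ) → Set
RainbowClique {n} c m =
  Σ (Fin m → Fin n) λ f →
    (∀ i j → f i ≡ f j → i ≡ j) ×
    (∀ i j i' j' → i F.< j → i' F.< j' →
       col c (f i) (f j) ≡ col c (f i') (f j') → (i ≡ i') × (j ≡ j'))

-- m = ⌊ √ℓ + 7/2 ⌋, characterised exactly:  m ≤ √ℓ + 7/2 < m + 1, i.e.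
-- 7 ≤ 2m, (2m - 7)² ≤ 4ℓ and 4ℓ < (2m - 5)²  (the case 2m - 7 < 0 cannot occur
-- since √ℓ + 7/2 ≥ 7/2 forces m ≥ 3 and then 2m ≥ 7 iff m ≥ 4, which holds).
IsFloorSqrtPlus7/2 : ℕ → ℕ → Set
IsFloorSqrtPlus7/2 ℓ m =
  (7 ≤ 2 * m) × ((2 * m ∸ 7) ^ 2 ≤ 4 * ℓ) × (4 * ℓ Data.Nat.< (2 * m ∸ 5) ^ 2)

-- Colour K_{ℓ+1}, on the vertices ∞ and ℤ/ℓ, by giving xy the colour x + y and ∞x the
-- colour 2x. For odd ℓ this is a proper colouring, so every colour class is a perfect
-- matching and the colouring is completely balanced. Blowing up every vertex of it into a
-- copy of a completely balanced colouring keeps complete balance, and a rainbow clique of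
-- such a blow-up lies in a single copy or meets every copy at most once; so iterating k
-- times gives K_{(ℓ+1)^k} without rainbow K_m as soon as the base colouring has none.
-- A rainbow K_m there is either m residues whose pairwise sums are distinct (a weak Sidon
-- set), or ∞ together with m - 1 residues whose sums, doubles included, are distinct (a
-- Sidon set). Counting the differences of such sets gives m(m - 1) ≤ ℓ + 2m, respectively
-- (m - 1)(m - 2) ≤ ℓ, and m = ⌊√ℓ + 7/2⌋ violates both.

module Submission where

open import Data.Bool using (Bool; true; false; if_then_else_)
open import Data.Empty using (⊥-elim)
open import Data.Fin as Fin
  using (Fin; zero; suc; toℕ; _↑ˡ_; _↑ʳ_; combine; remQuot; punchIn; punchOut; _<?_)
open import Data.Fin.Properties
  using ( toℕ-fromℕ<; toℕ-injective; toℕ<n; any?; injective⇒≤; <-cmp; <-asym; <⇒≢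
        ; punchIn-injective; punchInᵢ≢i; punchOut-injective; punchIn-punchOut
        ; remQuot-combine; combine-remQuot; combine-injectiveˡ; combine-injectiveʳ
        ; *↔×; +↔⊎; 2↔Bool )
open import Data.Fin.Subset using (Subset; ∣_∣)
open import Data.Nat as ℕ
  using (ℕ; zero; suc; NonZero; _+_; _*_; _∸_; _^_; _%_; _/_; _≤_; _≰_; _<_; z≤n; s≤s; s≤s⁻¹)
open import Data.Nat.DivMod
  using ( _mod_; m%n<n; m<n⇒m%n≡m; %-distribˡ-+; %-distribˡ-*; [m+n]%n≡m%n; [m+kn]%n≡m%n
        ; m≡m%n+[m/n]*n )
open import Data.Nat.Divisibility using (_∣_; _∣0; ∣-refl; ∣m⇒∣m*n; ∣m∣n⇒∣m+n; m%n≡0⇒n∣m)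
open import Data.Nat.Properties
  using ( +-*-semiring; +-comm; +-assoc; +-identityʳ; *-identityˡ; *-zeroʳ; *-suc; <⇒≤; <⇒≱; 1+n≰n
        ; m+[n∸m]≡n; m+n∸m≡n; m+1+n≰m; *-cancelˡ-≤; +-monoˡ-≤; module ≤-Reasoning )
open import Data.Nat.Tactic.RingSolver using (solve-∀)
open import Algebra.Properties.Semiring.Sum +-*-semiring
  using (sum; sum-syntax; sum-cong-≗; sum-remove; ∑-distrib-+; *-distribʳ-sum)
open import Data.Product as Prod using (Σ; _×_; _,_; ∃; proj₁; proj₂; swap)
open import Data.Product.Function.NonDependent.Propositional using (_×-↔_)
open import Data.Product.Properties using (,-injective)
open import Data.Sum as Sum using (_⊎_; inj₁; inj₂; [_,_]′)
open import Data.Sum.Function.Propositional using (_⊎-↔_)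
open import Data.Sum.Properties using (inj₁-injective; inj₂-injective)
open import Data.Vec using ([]; _∷_; lookup)
open import Data.Vec.Properties using (lookup∘tabulate)
open import Defs hiding (sym)
open import Function.Base using (_∘_; _∋_)
open import Function.Bundles using (_↔_; _⇔_; Injection; mk↣; mk⇔)
open import Function.Construct.Composition using (_↣-∘_)
open import Function.Definitions using (Injective)
open import Function.Properties.Inverse using (↔⇒↣; ↔-refl; ↔-sym; ↔-trans)
open import Relation.Binary using (tri<; tri≈; tri>)
open import Relation.Binary.PropositionalEquality
open import Relation.Nullary using (¬_; Dec; yes; no; does; contradiction; ¬?; _×-dec_)
open import Relation.Nullary.Decidable using (dec-true; dec-false; does-⇔; decidable-stable)
open import Relation.Unary using (Decidable)

indicator : Bool → ℕ
indicator b = if b then 1 else 0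

count : ∀ {n} → (Fin n → Bool) → ℕ
count {n} p = ∑[ i < n ] indicator (p i)

count-cong : ∀ {n} {p q : Fin n → Bool} → (∀ i → p i ≡ q i) → count p ≡ count q
count-cong p≗q = sum-cong-≗ (cong indicator ∘ p≗q)

∣p∣≡count : ∀ {n} (p : Subset n) → ∣ p ∣ ≡ count (lookup p)
∣p∣≡count []          = refl
∣p∣≡count (true ∷ p)  = cong suc (∣p∣≡count p)
∣p∣≡count (false ∷ p) = ∣p∣≡count p

∑-const : ∀ n x → ∑[ i < n ] x ≡ x * n
∑-const zero    x = sym (*-zeroʳ x)
∑-const (suc n) x = trans (cong (x +_) (∑-const n x)) (sym (*-suc x n))

count-≡1 : ∀ {n} {P : Fin n → Set} (P? : Decidable P) {i} →
           P i → (∀ {j} → P j → j ≡ i) → count (does ∘ P?) ≡ 1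
count-≡1 {suc n} P? {i} Pi unique = begin
  count (does ∘ P?)
    ≡⟨ sum-remove {i = i} (indicator ∘ does ∘ P?) ⟩
  indicator (does (P? i)) + count (does ∘ P? ∘ punchIn i)
    ≡⟨ cong₂ _+_ (cong indicator (dec-true (P? i) Pi)) (count-cong elsewhere) ⟩
  1 + count {n} (λ _ → false)
    ≡⟨ cong suc (∑-const n 0) ⟩
  1 ∎
  where
  open ≡-Reasoning
  elsewhere : ∀ t → does (P? (punchIn i t)) ≡ false
  elsewhere t = dec-false (P? (punchIn i t)) (punchInᵢ≢i i t ∘ unique)

∑-↑ : ∀ m {n} (f : Fin (m + n) → ℕ) → sum f ≡ ∑[ i < m ] f (i ↑ˡ n) + ∑[ j < n ] f (m ↑ʳ j)
∑-↑ zero    f = refl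
∑-↑ (suc m) f = trans (cong (f zero +_) (∑-↑ m (f ∘ suc))) (sym (+-assoc (f zero) _ _))

∑-combine : ∀ m {n} (f : Fin (m * n) → ℕ) → sum f ≡ ∑[ i < m ] ∑[ j < n ] f (combine i j)
∑-combine zero    f = refl
∑-combine (suc m) {n} f =
  trans (∑-↑ n f) (cong (∑[ j < n ] f (j ↑ˡ (m * n)) +_) (∑-combine m {n} (λ k → f (n ↑ʳ k))))

Nbr : ∀ {n ℓ} → EdgeColoring n ℓ → Fin n → Fin ℓ → Fin n → Set
Nbr c v γ u = v ≢ u × col c v u ≡ γ

nbr? : ∀ {n ℓ} (c : EdgeColoring n ℓ) v γ → Decidable (Nbr c v γ)
nbr? c v γ u = ¬? (v Fin.≟ u) ×-dec (col c v u Fin.≟ γ)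

-- The first `with` unfolds colourNbhd, exposing its local selector to the second.
lookup-colourNbhd : ∀ {n ℓ} (c : EdgeColoring n ℓ) v γ u → lookup (colourNbhd c v γ) u ≡ does (nbr? c v γ u)
lookup-colourNbhd c v γ u with (lookup (colourNbhd c v γ) u ≡ _ ∋ lookup∘tabulate _ u)
... | unfolded with v Fin.≟ u
...   | yes _ = unfolded
...   | no _  = unfolded

colourDeg≡count : ∀ {n ℓ} (c : EdgeColoring n ℓ) v γ → colourDeg c v γ ≡ count (does ∘ nbr? c v γ)
colourDeg≡count c v γ = trans (∣p∣≡count (colourNbhd c v γ)) (count-cong (lookup-colourNbhd c v γ))

odd⇒%2≡1 : ∀ n → ¬ 2 ∣ n → n % 2 ≡ 1
odd⇒%2≡1 n ¬2∣n with n % 2 in eq | m%n<n n 2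
... | 0           | _               = contradiction (m%n≡0⇒n∣m n 2 eq) ¬2∣n
... | 1           | _               = refl
... | suc (suc _) | s≤s (s≤s ())

odd⇒≡1+[n/2]*2 : ∀ n → ¬ 2 ∣ n → n ≡ 1 + n / 2 * 2
odd⇒≡1+[n/2]*2 n ¬2∣n = trans (m≡m%n+[m/n]*n n 2) (cong (_+ n / 2 * 2) (odd⇒%2≡1 n ¬2∣n))

module _ {ℓ : ℕ} .{{_ : NonZero ℓ}} where

  open ≡-Reasoning

  infixl 6 _⊕_ _⊖_

  _⊕_ : Fin ℓ → Fin ℓ → Fin ℓ
  x ⊕ y = (toℕ x + toℕ y) mod ℓ

  _⊖_ : Fin ℓ → Fin ℓ → Fin ℓ
  x ⊖ y = (toℕ x + (ℓ ∸ toℕ y)) mod ℓ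

  private
    mod⇒% : ∀ {a b} → a mod ℓ ≡ b mod ℓ → a % ℓ ≡ b % ℓ
    mod⇒% {a} {b} eq = trans (sym (toℕ-fromℕ< (m%n<n a ℓ))) (trans (cong toℕ eq) (toℕ-fromℕ< (m%n<n b ℓ)))

    %⇒mod : ∀ {a b} → a % ℓ ≡ b % ℓ → a mod ℓ ≡ b mod ℓ
    %⇒mod {a} {b} eq =
      toℕ-injective (trans (toℕ-fromℕ< (m%n<n a ℓ)) (trans eq (sym (toℕ-fromℕ< (m%n<n b ℓ)))))

    %⇒≡ : ∀ {x y : Fin ℓ} → toℕ x % ℓ ≡ toℕ y % ℓ → x ≡ y
    %⇒≡ {x} {y} eq = toℕ-injective (trans (sym (m<n⇒m%n≡m (toℕ<n x))) (trans eq (m<n⇒m%n≡m (toℕ<n y))))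

    %-cong-+ʳ : ∀ {a b} c → a % ℓ ≡ b % ℓ → (a + c) % ℓ ≡ (b + c) % ℓ
    %-cong-+ʳ {a} {b} c eq = begin
      (a + c) % ℓ               ≡⟨ %-distribˡ-+ a c ℓ ⟩
      (a % ℓ + c % ℓ) % ℓ       ≡⟨ cong (λ r → (r + c % ℓ) % ℓ) eq ⟩
      (b % ℓ + c % ℓ) % ℓ       ≡⟨ %-distribˡ-+ b c ℓ ⟨
      (b + c) % ℓ               ∎

    %-cong-*ˡ : ∀ {a b} k → a % ℓ ≡ b % ℓ → (k * a) % ℓ ≡ (k * b) % ℓ
    %-cong-*ˡ {a} {b} k eq = begin
      (k * a) % ℓ               ≡⟨ %-distribˡ-* k a ℓ ⟩
      (k % ℓ * (a % ℓ)) % ℓ     ≡⟨ cong (λ r → (k % ℓ * r) % ℓ) eq ⟩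
      (k % ℓ * (b % ℓ)) % ℓ     ≡⟨ %-distribˡ-* k b ℓ ⟨
      (k * b) % ℓ               ∎

    +ℓ-split : ∀ (x : Fin ℓ) a → a + ℓ ≡ a + toℕ x + (ℓ ∸ toℕ x)
    +ℓ-split x a = begin
      a + ℓ                         ≡⟨ cong (a +_) (m+[n∸m]≡n (<⇒≤ (toℕ<n x))) ⟨
      a + (toℕ x + (ℓ ∸ toℕ x))     ≡⟨ +-assoc a (toℕ x) _ ⟨
      a + toℕ x + (ℓ ∸ toℕ x)       ∎

  ⊕-comm : ∀ x y → x ⊕ y ≡ y ⊕ x
  ⊕-comm x y = cong (_mod ℓ) (+-comm (toℕ x) (toℕ y))

  ⊕-cancelˡ : ∀ x {y z} → x ⊕ y ≡ x ⊕ z → y ≡ z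
  ⊕-cancelˡ x {y} {z} eq = %⇒≡ (begin
    Y % ℓ                     ≡⟨ [m+n]%n≡m%n Y ℓ ⟨
    (Y + ℓ) % ℓ               ≡⟨ cong (_% ℓ) (+ℓ-split x Y) ⟩
    (Y + X + (ℓ ∸ X)) % ℓ     ≡⟨ %-cong-+ʳ (ℓ ∸ X) Y+X≡Z+X ⟩
    (Z + X + (ℓ ∸ X)) % ℓ     ≡⟨ cong (_% ℓ) (+ℓ-split x Z) ⟨
    (Z + ℓ) % ℓ               ≡⟨ [m+n]%n≡m%n Z ℓ ⟩
    Z % ℓ                     ∎)
    where
    X = toℕ x; Y = toℕ y; Z = toℕ z
    Y+X≡Z+X : (Y + X) % ℓ ≡ (Z + X) % ℓ
    Y+X≡Z+X = subst₂ (λ a b → a % ℓ ≡ b % ℓ) (+-comm X Y) (+-comm X Z) (mod⇒% eq)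

  ⊖≡⊖⇒⊕≡⊕ : ∀ x y x' y' → x ⊖ y ≡ x' ⊖ y' → x ⊕ y' ≡ x' ⊕ y
  ⊖≡⊖⇒⊕≡⊕ x y x' y' eq = %⇒mod (begin
    (X + Y') % ℓ                         ≡⟨ [m+n]%n≡m%n (X + Y') ℓ ⟨
    (X + Y' + ℓ) % ℓ                     ≡⟨ cong (_% ℓ) (+ℓ-split y (X + Y')) ⟩
    (X + Y' + Y + (ℓ ∸ Y)) % ℓ           ≡⟨ cong (_% ℓ) (regroup₁ X Y' Y (ℓ ∸ Y)) ⟩
    (X + (ℓ ∸ Y) + (Y + Y')) % ℓ         ≡⟨ %-cong-+ʳ (Y + Y') (mod⇒% eq) ⟩
    (X' + (ℓ ∸ Y') + (Y + Y')) % ℓ       ≡⟨ cong (_% ℓ) (regroup₂ X' Y Y' (ℓ ∸ Y')) ⟩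
    (X' + Y + Y' + (ℓ ∸ Y')) % ℓ         ≡⟨ cong (_% ℓ) (+ℓ-split y' (X' + Y)) ⟨
    (X' + Y + ℓ) % ℓ                     ≡⟨ [m+n]%n≡m%n (X' + Y) ℓ ⟩
    (X' + Y) % ℓ                         ∎)
    where
    X = toℕ x; Y = toℕ y; X' = toℕ x'; Y' = toℕ y'
    regroup₁ : ∀ a b c d → a + b + c + d ≡ a + d + (c + b)
    regroup₁ = solve-∀
    regroup₂ : ∀ a b c d → a + d + (b + c) ≡ a + b + c + d
    regroup₂ = solve-∀

  ⊕-double-injective : ¬ 2 ∣ ℓ → ∀ {x y} → x ⊕ x ≡ y ⊕ y → x ≡ y
  ⊕-double-injective ℓ-odd {x} {y} eq = %⇒≡ (begin
    X % ℓ                     ≡⟨ [m+kn]%n≡m%n X X ℓ ⟨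
    (X + X * ℓ) % ℓ           ≡⟨ cong (_% ℓ) (halve X) ⟨
    (h * (X + X)) % ℓ         ≡⟨ %-cong-*ˡ h (mod⇒% eq) ⟩
    (h * (Y + Y)) % ℓ         ≡⟨ cong (_% ℓ) (halve Y) ⟩
    (Y + Y * ℓ) % ℓ           ≡⟨ [m+kn]%n≡m%n Y Y ℓ ⟩
    Y % ℓ                     ∎)
    where
    X = toℕ x; Y = toℕ y
    -- h = (ℓ + 1) / 2 inverts 2 modulo the odd number ℓ
    h = suc (ℓ / 2)
    halve : ∀ a → h * (a + a) ≡ a + a * ℓ
    halve a = trans (identity (ℓ / 2) a) (cong (λ n → a + a * n) (sym (odd⇒≡1+[n/2]*2 ℓ ℓ-odd)))
      where
      identity : ∀ q a → suc q * (a + a) ≡ a + a * (1 + q * 2)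
      identity = solve-∀

injective⇒surjective : ∀ {n} {f : Fin n → Fin n} → Injective _≡_ _≡_ f → ∀ y → ∃ λ x → f x ≡ y
injective⇒surjective {suc n} {f} f-inj y with any? (λ x → f x Fin.≟ y)
... | yes found = found
... | no missed = contradiction (injective⇒≤ f-inj′) 1+n≰n
  where
  -- f misses y, so it factors injectively through Fin n
  y≢f : ∀ x → y ≢ f x
  y≢f x y≡fx = missed (x , sym y≡fx)
  f′ : Fin (suc n) → Fin n
  f′ x = punchOut (y≢f x)
  f-inj′ : Injective _≡_ _≡_ f′
  f-inj′ {x} {x'} = f-inj ∘ punchOut-injective (y≢f x) (y≢f x')

injective⇒≤-via : ∀ {m n} {A B : Set} {f : A → B} →
                  Injective _≡_ _≡_ f → Fin m ↔ A → B ↔ Fin n → m ≤ n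
injective⇒≤-via f-inj A↔ B↔ =
  injective⇒≤ (Injection.injective (↔⇒↣ B↔ ↣-∘ (mk↣ f-inj ↣-∘ ↔⇒↣ A↔)))

-- The ordered pairs (i , j) with i ≢ j, written as j = punchIn i t.
distinctPairs-≤ : ∀ {s n} {B : Set} (g : Fin (suc s) → Fin s → B) →
                  (∀ {i t i' t'} → g i t ≡ g i' t' → i ≡ i' × t ≡ t') → B ↔ Fin n → suc s * s ≤ n
distinctPairs-≤ g g-inj B↔ = injective⇒≤-via inj *↔× B↔
  where
  inj : Injective _≡_ _≡_ (λ (p : _ × _) → g (proj₁ p) (proj₂ p))
  inj eq with refl , refl ← g-inj eq = refl

-- Sidon sets

SamePair : ∀ {m} → Fin m → Fin m → Fin m → Fin m → Set
SamePair i j i' j' = (i ≡ i' × j ≡ j') ⊎ (i ≡ j' × j ≡ i')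

PairInjective : ∀ {m} {A : Set} → (Fin m → Fin m → A) → Set
PairInjective g = ∀ {i j i' j'} → i ≢ j → i' ≢ j' → g i j ≡ g i' j' → SamePair i j i' j'

<?-flip : ∀ {n} {i k : Fin n} → i ≢ k → does (i <? k) ≢ does (k <? i)
<?-flip {i = i} {k} i≢k with <-cmp i k
... | tri< i<k _ _ rewrite dec-true (i <? k) i<k | dec-false (k <? i) (<-asym i<k) = λ ()
... | tri≈ _ i≡k _ = contradiction i≡k i≢k
... | tri> _ _ k<i rewrite dec-false (i <? k) (<-asym k<i) | dec-true (k <? i) k<i = λ ()

module _ {ℓ : ℕ} .{{_ : NonZero ℓ}} where

  Sidon : ∀ {s} → (Fin s → Fin ℓ) → Set
  Sidon x = ∀ {i j i' j'} → x i ⊕ x j ≡ x i' ⊕ x j' → SamePair i j i' j'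

  WeakSidon : ∀ {s} → (Fin s → Fin ℓ) → Set
  WeakSidon x = PairInjective (λ i j → x i ⊕ x j)

  sidon-bound : ∀ {s} {x : Fin s → Fin ℓ} → Sidon x → s * (s ∸ 1) ≤ ℓ
  sidon-bound {zero}      _     = z≤n
  sidon-bound {suc s} {x} sidon = distinctPairs-≤ (λ i t → x i ⊖ x (punchIn i t)) differences-injective ↔-refl
    where
    differences-injective : ∀ {i t i' t'} → x i ⊖ x (punchIn i t) ≡ x i' ⊖ x (punchIn i' t') →
                            i ≡ i' × t ≡ t'
    differences-injective {i} {t} {i'} {t'} eq
      with sidon {i} {punchIn i' t'} {i'} {punchIn i t}
                 (⊖≡⊖⇒⊕≡⊕ (x i) (x (punchIn i t)) (x i') (x (punchIn i' t')) eq)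
    ... | inj₁ (refl , pt′≡pt) = refl , sym (punchIn-injective i t' t pt′≡pt)
    ... | inj₂ (_ , pt′≡i′)    = contradiction pt′≡i′ (punchInᵢ≢i i' t')

  weakSidon-bound : ¬ 2 ∣ ℓ → ∀ {s} {x : Fin s → Fin ℓ} → Injective _≡_ _≡_ x → WeakSidon x →
                    s * (s ∸ 1) ≤ ℓ + s * 2
  weakSidon-bound ℓ-odd {zero}      _     _    = z≤n
  weakSidon-bound ℓ-odd {suc s} {x} x-inj weak =
    distinctPairs-≤ (λ i t → code i (punchIn i t)) codes-injective codes↔
    where
    Midpoint : Fin (suc s) → Fin (suc s) → Set
    Midpoint i j = ∃ λ k → i ≢ k × x i ⊕ x k ≡ x j ⊕ x j

    -- A difference x i ⊖ x j can only repeat when x j is the midpoint of x i and some x k;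
    -- by weak Sidon-ness {i , k} is then determined by j, so j and the orientation of {i , k}
    -- code the pair instead.
    code′ : ∀ i j → Dec (Midpoint i j) → Fin ℓ ⊎ (Fin (suc s) × Bool)
    code′ i j (yes (k , _)) = inj₂ (j , does (i <? k))
    code′ i j (no _)        = inj₁ (x i ⊖ x j)

    code : Fin (suc s) → Fin (suc s) → Fin ℓ ⊎ (Fin (suc s) × Bool)
    code i j = code′ i j (any? λ k → ¬? (i Fin.≟ k) ×-dec (x i ⊕ x k Fin.≟ x j ⊕ x j))

    code′-injective : ∀ i j i' j' → i ≢ j → i' ≢ j' → ∀ d d' →
                      code′ i j d ≡ code′ i' j' d' → i ≡ i' × j ≡ j'
    code′-injective i j i' j' _ _ (yes (k , i≢k , mid)) (yes (k' , i'≢k' , mid')) eq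
      with refl , bits ← ,-injective (inj₂-injective eq)
      with weak i≢k i'≢k' (trans mid (sym mid'))
    ... | inj₁ (i≡i' , _)  = i≡i' , refl
    ... | inj₂ (refl , refl) = contradiction bits (<?-flip i≢k)
    code′-injective i j i' j' i≢j i'≢j' (no ¬mid) (no ¬mid') eq
      with ⊖≡⊖⇒⊕≡⊕ (x i) (x j) (x i') (x j') (inj₁-injective eq) | i Fin.≟ j' | i' Fin.≟ j
    ... | sums | no i≢j' | no i'≢j with weak i≢j' i'≢j sums
    ...   | inj₁ (i≡i' , j'≡j) = i≡i' , sym j'≡j
    ...   | inj₂ (i≡j , _)     = contradiction i≡j i≢j
    code′-injective i j i' j' i≢j i'≢j' (no ¬mid) (no ¬mid') eq | sums | yes refl | no i'≢j =
      contradiction (j , i'≢j , sym sums) ¬mid'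
    code′-injective i j i' j' i≢j i'≢j' (no ¬mid) (no ¬mid') eq | sums | no i≢j' | yes refl =
      contradiction (j' , i≢j' , sums) ¬mid
    code′-injective i j i' j' i≢j i'≢j' (no ¬mid) (no ¬mid') eq | sums | yes refl | yes refl =
      contradiction (x-inj (⊕-double-injective ℓ-odd sums)) i≢j

    codes-injective : ∀ {i t i' t'} → code i (punchIn i t) ≡ code i' (punchIn i' t') → i ≡ i' × t ≡ t'
    codes-injective {i} {t} {i'} {t'} eq
      with refl , pt≡pt′ ←
           code′-injective _ _ _ _ (punchInᵢ≢i i t ∘ sym) (punchInᵢ≢i i' t' ∘ sym) _ _ eq
      = refl , punchIn-injective i t t' pt≡pt′

    codes↔ : (Fin ℓ ⊎ (Fin (suc s) × Bool)) ↔ Fin (ℓ + suc s * 2)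
    codes↔ = ↔-trans (↔-refl ⊎-↔ ↔-trans (↔-refl ×-↔ ↔-sym 2↔Bool) (↔-sym *↔×)) (↔-sym +↔⊎)

-- Rainbow cliques and lexicographic products

Rainbow : ∀ {n ℓ m} → EdgeColoring n ℓ → (Fin m → Fin n) → Set
Rainbow c f = PairInjective (λ i j → col c (f i) (f j))

rainbowClique⇒rainbow : ∀ {n ℓ m} {c : EdgeColoring n ℓ} → RainbowClique c m →
                        Σ (Fin m → Fin n) λ f → Injective _≡_ _≡_ f × Rainbow c f
rainbowClique⇒rainbow {c = c} (f , f-inj , ordered) = f , f-inj _ _ , rainbow
  where
  rainbow : Rainbow c f
  rainbow {i} {j} {i'} {j'} i≢j i'≢j' eq with <-cmp i j | <-cmp i' j'
  ... | tri≈ _ i≡j _ | _              = contradiction i≡j i≢j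
  ... | _            | tri≈ _ i'≡j' _ = contradiction i'≡j' i'≢j'
  ... | tri< i<j _ _ | tri< i'<j' _ _ = inj₁ (ordered i j i' j' i<j i'<j' eq)
  ... | tri< i<j _ _ | tri> _ _ j'<i' = inj₂ (ordered i j j' i' i<j j'<i' (trans eq (EdgeColoring.sym c _ _)))
  ... | tri> _ _ j<i | tri< i'<j' _ _ = inj₂ (swap (ordered j i i' j' j<i i'<j' (trans (EdgeColoring.sym c _ _) eq)))
  ... | tri> _ _ j<i | tri> _ _ j'<i' =
    inj₁ (swap (ordered j i j' i' j<i j'<i' (trans (EdgeColoring.sym c _ _) (trans eq (EdgeColoring.sym c _ _)))))

rainbow⇒rainbowClique : ∀ {n ℓ m} {c : EdgeColoring n ℓ} {f : Fin m → Fin n} →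
                        Injective _≡_ _≡_ f → Rainbow c f → RainbowClique c m
rainbow⇒rainbowClique {c = c} {f} f-inj rainbow = f , (λ _ _ → f-inj) , ordered
  where
  ordered : ∀ i j i' j' → i Fin.< j → i' Fin.< j' →
            col c (f i) (f j) ≡ col c (f i') (f j') → i ≡ i' × j ≡ j'
  ordered i j i' j' i<j i'<j' eq with rainbow (<⇒≢ i<j) (<⇒≢ i'<j') eq
  ... | inj₁ same          = same
  ... | inj₂ (refl , refl) = contradiction i'<j' (<-asym i<j)

¬rainbowClique-small : ∀ {n ℓ m} {c : EdgeColoring n ℓ} → n ℕ.< m → ¬ RainbowClique c m
¬rainbowClique-small n<m (_ , f-inj , _) = <⇒≱ n<m (injective⇒≤ (f-inj _ _))

module _ {n₁ n₂ ℓ} (c₁ : EdgeColoring n₁ ℓ) (c₂ : EdgeColoring n₂ ℓ) where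

  lexCol : Fin n₁ × Fin n₂ → Fin n₁ × Fin n₂ → Fin ℓ
  lexCol (a , x) (b , y) with a Fin.≟ b
  ... | yes _ = col c₂ x y
  ... | no _  = col c₁ a b

  lexCol-sym : ∀ p q → lexCol p q ≡ lexCol q p
  lexCol-sym (a , x) (b , y) with a Fin.≟ b | b Fin.≟ a
  ... | yes _   | yes _   = EdgeColoring.sym c₂ x y
  ... | no _    | no _    = EdgeColoring.sym c₁ a b
  ... | yes a≡b | no b≢a  = contradiction (sym a≡b) b≢a
  ... | no a≢b  | yes b≡a = contradiction (sym b≡a) a≢b

  lexCol-inner : ∀ {a b} x y → a ≡ b → lexCol (a , x) (b , y) ≡ col c₂ x y
  lexCol-inner {a} {b} x y a≡b with a Fin.≟ b
  ... | yes _   = refl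
  ... | no a≢b  = contradiction a≡b a≢b

  lexCol-outer : ∀ {a b} x y → a ≢ b → lexCol (a , x) (b , y) ≡ col c₁ a b
  lexCol-outer {a} {b} x y a≢b with a Fin.≟ b
  ... | yes a≡b = contradiction a≡b a≢b
  ... | no _    = refl

infixl 7 _⊗_

_⊗_ : ∀ {n₁ n₂ ℓ} → EdgeColoring n₁ ℓ → EdgeColoring n₂ ℓ → EdgeColoring (n₁ * n₂) ℓ
col (_⊗_ {n₂ = n₂} c₁ c₂) u v = lexCol c₁ c₂ (remQuot n₂ u) (remQuot n₂ v)
EdgeColoring.sym (_⊗_ {n₂ = n₂} c₁ c₂) u v = lexCol-sym c₁ c₂ (remQuot n₂ u) (remQuot n₂ v)

module _ {n₁ n₂ ℓ} {c₁ : EdgeColoring n₁ ℓ} {c₂ : EdgeColoring n₂ ℓ} where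

  col-⊗ : ∀ a x b y → col (c₁ ⊗ c₂) (combine a x) (combine b y) ≡ lexCol c₁ c₂ (a , x) (b , y)
  col-⊗ a x b y = cong₂ (lexCol c₁ c₂) (remQuot-combine a x) (remQuot-combine b y)

  colourDeg-⊗ : ∀ a x γ →
                colourDeg (c₁ ⊗ c₂) (combine a x) γ ≡ colourDeg c₁ a γ * n₂ + colourDeg c₂ x γ
  colourDeg-⊗ a x γ = begin
    colourDeg (c₁ ⊗ c₂) (combine a x) γ
      ≡⟨ colourDeg≡count (c₁ ⊗ c₂) (combine a x) γ ⟩
    count nbr
      ≡⟨ ∑-combine n₁ (indicator ∘ nbr) ⟩
    ∑[ b < n₁ ] count (λ y → nbr (combine b y))
      ≡⟨ sum-cong-≗ block ⟩
    ∑[ b < n₁ ] (outer b * n₂ + inner b * d₂)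
      ≡⟨ ∑-distrib-+ (λ b → outer b * n₂) (λ b → inner b * d₂) ⟩
    ∑[ b < n₁ ] (outer b * n₂) + ∑[ b < n₁ ] (inner b * d₂)
      ≡⟨ cong₂ _+_ (*-distribʳ-sum n₂ outer) (*-distribʳ-sum d₂ inner) ⟨
    count (does ∘ nbr? c₁ a γ) * n₂ + count (does ∘ (a Fin.≟_)) * d₂
      ≡⟨ cong₂ (λ d k → d * n₂ + k * d₂)
               (sym (colourDeg≡count c₁ a γ)) (count-≡1 (a Fin.≟_) refl sym) ⟩
    colourDeg c₁ a γ * n₂ + 1 * d₂
      ≡⟨ cong (colourDeg c₁ a γ * n₂ +_) (*-identityˡ d₂) ⟩
    colourDeg c₁ a γ * n₂ + d₂
      ∎
    where
    open ≡-Reasoning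
    d₂ = colourDeg c₂ x γ
    nbr : Fin (n₁ * n₂) → Bool
    nbr = does ∘ nbr? (c₁ ⊗ c₂) (combine a x) γ
    outer inner : Fin n₁ → ℕ
    outer b = indicator (does (nbr? c₁ a γ b))
    inner b = indicator (does (a Fin.≟ b))

    block : ∀ b → count (λ y → nbr (combine b y)) ≡ outer b * n₂ + inner b * d₂
    block b with a Fin.≟ b
    ... | yes refl = begin
      count (λ y → nbr (combine a y))
        ≡⟨ count-cong (λ y → does-⇔ (same-block y) (nbr? (c₁ ⊗ c₂) (combine a x) γ (combine a y))
                                                   (nbr? c₂ x γ y)) ⟩
      count (does ∘ nbr? c₂ x γ)
        ≡⟨ colourDeg≡count c₂ x γ ⟨
      d₂
        ≡⟨ *-identityˡ d₂ ⟨
      1 * d₂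
        ∎
      where
      colour : ∀ y → col (c₁ ⊗ c₂) (combine a x) (combine a y) ≡ col c₂ x y
      colour y = trans (col-⊗ a x a y) (lexCol-inner c₁ c₂ {a} {a} x y refl)
      same-block : ∀ y → Nbr (c₁ ⊗ c₂) (combine a x) γ (combine a y) ⇔ Nbr c₂ x γ y
      same-block y = mk⇔
        (λ (≢ , eq) → (≢ ∘ cong (combine a)) , trans (sym (colour y)) eq)
        (λ (≢ , eq) → (≢ ∘ combine-injectiveʳ a x a y) , trans (colour y) eq)
    ... | no a≢b = begin
      count (λ y → nbr (combine b y))
        ≡⟨ count-cong (λ y → does-⇔ (other-block y) (nbr? (c₁ ⊗ c₂) (combine a x) γ (combine b y))
                                                    (col c₁ a b Fin.≟ γ)) ⟩
      count {n₂} (λ _ → does (col c₁ a b Fin.≟ γ))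
        ≡⟨ ∑-const n₂ _ ⟩
      indicator (does (col c₁ a b Fin.≟ γ)) * n₂
        ≡⟨ +-identityʳ _ ⟨
      indicator (does (col c₁ a b Fin.≟ γ)) * n₂ + 0
        ∎
      where
      colour : ∀ y → col (c₁ ⊗ c₂) (combine a x) (combine b y) ≡ col c₁ a b
      colour y = trans (col-⊗ a x b y) (lexCol-outer c₁ c₂ x y a≢b)
      other-block : ∀ y → Nbr (c₁ ⊗ c₂) (combine a x) γ (combine b y) ⇔ (col c₁ a b ≡ γ)
      other-block y = mk⇔
        (λ (_ , eq) → trans (sym (colour y)) eq)
        (λ eq → (a≢b ∘ combine-injectiveˡ a x b y) , trans (colour y) eq)

  completelyBalanced-⊗ : CompletelyBalanced c₁ → CompletelyBalanced c₂ → CompletelyBalanced (c₁ ⊗ c₂)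
  completelyBalanced-⊗ (ℓ∣n₁-1 , deg₁) (ℓ∣n₂-1 , deg₂) = ℓ∣mn-1 n₁ n₂ ℓ∣n₁-1 ℓ∣n₂-1 , deg
    where
    ℓ∣mn-1 : ∀ m n → ℓ ∣ m ∸ 1 → ℓ ∣ n ∸ 1 → ℓ ∣ m * n ∸ 1
    ℓ∣mn-1 zero    _       _   _   = ℓ ∣0
    ℓ∣mn-1 (suc p) zero    _   _   rewrite *-zeroʳ p = ℓ ∣0
    ℓ∣mn-1 (suc p) (suc q) ℓ∣p ℓ∣q = ∣m∣n⇒∣m+n ℓ∣q (∣m⇒∣m*n (suc q) ℓ∣p)

    deg-combine : ∀ a x γ → colourDeg (c₁ ⊗ c₂) (combine a x) γ * ℓ ≡ n₁ * n₂ ∸ 1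
    deg-combine a x γ = begin
      colourDeg (c₁ ⊗ c₂) (combine a x) γ * ℓ  ≡⟨ cong (_* ℓ) (colourDeg-⊗ a x γ) ⟩
      (d₁ * n₂ + d₂) * ℓ                       ≡⟨ regroup d₁ n₂ d₂ ℓ ⟩
      d₁ * ℓ * n₂ + d₂ * ℓ                     ≡⟨ cong₂ (λ p q → p * n₂ + q) (deg₁ a γ) (deg₂ x γ) ⟩
      (n₁ ∸ 1) * n₂ + (n₂ ∸ 1)                 ≡⟨ pred-* a x ⟩
      n₁ * n₂ ∸ 1                              ∎
      where
      open ≡-Reasoning
      d₁ = colourDeg c₁ a γ
      d₂ = colourDeg c₂ x γ
      regroup : ∀ d n e l → (d * n + e) * l ≡ d * l * n + e * l
      regroup = solve-∀
      pred-* : ∀ {m n} → Fin m → Fin n → (m ∸ 1) * n + (n ∸ 1) ≡ m * n ∸ 1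
      pred-* {suc p} {suc q} _ _ = +-comm (p * suc q) q

    deg : ∀ v γ → colourDeg (c₁ ⊗ c₂) v γ * ℓ ≡ n₁ * n₂ ∸ 1
    deg v γ = subst (λ u → colourDeg (c₁ ⊗ c₂) u γ * ℓ ≡ n₁ * n₂ ∸ 1) (combine-remQuot {n₁} n₂ v)
                    (deg-combine (proj₁ (remQuot {n₁} n₂ v)) (proj₂ (remQuot {n₁} n₂ v)) γ)

  module _ {m} {f : Fin m → Fin (n₁ * n₂)} (f-inj : Injective _≡_ _≡_ f) (rainbow : Rainbow (c₁ ⊗ c₂) f)
           where

    private
      block : Fin m → Fin n₁
      block i = proj₁ (remQuot {n₁} n₂ (f i))

      pos : Fin m → Fin n₂
      pos i = proj₂ (remQuot {n₁} n₂ (f i))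

      one-block : (∀ i j → block i ≡ block j) → RainbowClique c₂ m
      one-block same = rainbow⇒rainbowClique {c = c₂} pos-inj rainbow₂
        where
        pos-inj : Injective _≡_ _≡_ pos
        pos-inj {i} {j} eq = f-inj (begin
          f i                        ≡⟨ combine-remQuot {n₁} n₂ (f i) ⟨
          combine (block i) (pos i)  ≡⟨ cong₂ combine (same i j) eq ⟩
          combine (block j) (pos j)  ≡⟨ combine-remQuot {n₁} n₂ (f j) ⟩
          f j                        ∎)
          where open ≡-Reasoning
        rainbow₂ : Rainbow c₂ pos
        rainbow₂ {i} {j} {i'} {j'} i≢j i'≢j' eq = rainbow i≢j i'≢j'
          (trans (lexCol-inner c₁ c₂ (pos i) (pos j) (same i j))
                 (trans eq (sym (lexCol-inner c₁ c₂ (pos i') (pos j') (same i' j')))))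

      two-blocks : ∀ {i₀ j₀} → block i₀ ≢ block j₀ → RainbowClique c₁ m
      two-blocks {i₀} {j₀} split = rainbow⇒rainbowClique {c = c₁} block-inj rainbow₁
        where
        elsewhere : ∀ p → ∃ λ t → block p ≢ block t
        elsewhere p with block p Fin.≟ block i₀
        ... | yes same  = j₀ , split ∘ trans (sym same)
        ... | no differ = i₀ , differ

        -- two clique vertices in one block would see a third one in another block in the same colour
        block-inj : Injective _≡_ _≡_ block
        block-inj {p} {q} bp≡bq with t , bp≢bt ← elsewhere p
          with rainbow {p} {t} {q} {t} (bp≢bt ∘ cong block) (bq≢bt ∘ cong block) same-colour
          where
          bq≢bt = bp≢bt ∘ trans bp≡bq
          same-colour = trans (lexCol-outer c₁ c₂ (pos p) (pos t) bp≢bt)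
                        (trans (cong (λ b → col c₁ b (block t)) bp≡bq)
                               (sym (lexCol-outer c₁ c₂ (pos q) (pos t) bq≢bt)))
        ... | inj₁ (p≡q , _) = p≡q
        ... | inj₂ (p≡t , _) = contradiction (cong block p≡t) bp≢bt

        rainbow₁ : Rainbow c₁ block
        rainbow₁ {i} {j} {i'} {j'} i≢j i'≢j' eq = rainbow i≢j i'≢j'
          (trans (lexCol-outer c₁ c₂ (pos i) (pos j) (i≢j ∘ block-inj))
                 (trans eq (sym (lexCol-outer c₁ c₂ (pos i') (pos j') (i'≢j' ∘ block-inj)))))

    rainbow-⊗ : RainbowClique c₁ m ⊎ RainbowClique c₂ m
    rainbow-⊗ with any? (λ i → any? (λ j → ¬? (block i Fin.≟ block j)))
    ... | yes (_ , _ , split) = inj₁ (two-blocks split)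
    ... | no ¬split           = inj₂ (one-block λ i j →
      decidable-stable (block i Fin.≟ block j) (λ split → ¬split (i , j , split)))

  rainbowClique-⊗ : ∀ {m} → RainbowClique (c₁ ⊗ c₂) m → RainbowClique c₁ m ⊎ RainbowClique c₂ m
  rainbowClique-⊗ R with f , f-inj , rainbow ← rainbowClique⇒rainbow {c = c₁ ⊗ c₂} R = rainbow-⊗ f-inj rainbow

K₁ : ∀ {ℓ} → Fin ℓ → EdgeColoring 1 ℓ
col (K₁ γ) _ _ = γ
EdgeColoring.sym (K₁ γ) _ _ = refl

completelyBalanced-K₁ : ∀ {ℓ} (γ : Fin ℓ) → CompletelyBalanced (K₁ γ)
completelyBalanced-K₁ {ℓ} γ = ℓ ∣0 , λ { zero _ → refl }

lexPower : ∀ {n ℓ} → Fin ℓ → EdgeColoring n ℓ → (k : ℕ) → EdgeColoring (n ^ k) ℓ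
lexPower γ c zero    = K₁ γ
lexPower γ c (suc k) = c ⊗ lexPower γ c k

completelyBalanced-lexPower : ∀ {n ℓ} (γ : Fin ℓ) {c : EdgeColoring n ℓ} → CompletelyBalanced c →
                              ∀ k → CompletelyBalanced (lexPower γ c k)
completelyBalanced-lexPower γ _  zero    = completelyBalanced-K₁ γ
completelyBalanced-lexPower γ cb (suc k) = completelyBalanced-⊗ cb (completelyBalanced-lexPower γ cb k)

¬rainbowClique-lexPower : ∀ {n ℓ m} (γ : Fin ℓ) {c : EdgeColoring n ℓ} → 1 ℕ.< m → ¬ RainbowClique c m →
                          ∀ k → ¬ RainbowClique (lexPower γ c k) m
¬rainbowClique-lexPower γ 1<m ¬R zero    = ¬rainbowClique-small {c = K₁ γ} 1<m
¬rainbowClique-lexPower γ 1<m ¬R (suc k) = [ ¬R , ¬rainbowClique-lexPower γ 1<m ¬R k ]′ ∘ rainbowClique-⊗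

-- The base colouring

Proper : ∀ {n ℓ} → EdgeColoring n ℓ → Set
Proper c = ∀ {v u u'} → v ≢ u → v ≢ u' → col c v u ≡ col c v u' → u ≡ u'

-- ℓ colours on the ℓ edges at each vertex of K_{ℓ+1}: properness forces each colour exactly once
proper⇒completelyBalanced : ∀ {ℓ} (c : EdgeColoring (suc ℓ) ℓ) → Proper c → CompletelyBalanced c
proper⇒completelyBalanced {ℓ} c proper = ∣-refl , λ v γ → trans (cong (_* ℓ) (colourDeg≡1 v γ)) (*-identityˡ ℓ)
  where
  v≢ : ∀ v t → v ≢ punchIn v t
  v≢ v t = punchInᵢ≢i v t ∘ sym

  edges-inj : ∀ v → Injective _≡_ _≡_ (λ t → col c v (punchIn v t))
  edges-inj v {t} {t'} eq = punchIn-injective v t t' (proper (v≢ v t) (v≢ v t') eq)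

  colourDeg≡1 : ∀ v γ → colourDeg c v γ ≡ 1
  colourDeg≡1 v γ with t , coloured ← injective⇒surjective (edges-inj v) γ =
    trans (colourDeg≡count c v γ) (count-≡1 (nbr? c v γ) (v≢ v t , coloured)
      λ (v≢u , coloured′) → proper v≢u (v≢ v t) (trans coloured′ (sym coloured)))

module _ {ℓ : ℕ} .{{_ : NonZero ℓ}} where

  -- Vertex zero is a point at infinity and suc x is the residue x; an edge at infinity
  -- takes the colour of the doubled residue. (The colour of the loop at zero is immaterial.)
  base : Fin (suc ℓ) → Fin (suc ℓ) → Fin ℓ
  base zero    zero    = 0 mod ℓ
  base zero    (suc y) = y ⊕ y
  base (suc x) zero    = x ⊕ x
  base (suc x) (suc y) = x ⊕ y

  baseColouring : EdgeColoring (suc ℓ) ℓ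
  col baseColouring = base
  EdgeColoring.sym baseColouring zero    zero    = refl
  EdgeColoring.sym baseColouring zero    (suc y) = refl
  EdgeColoring.sym baseColouring (suc x) zero    = refl
  EdgeColoring.sym baseColouring (suc x) (suc y) = ⊕-comm x y

  base-proper : ¬ 2 ∣ ℓ → Proper baseColouring
  base-proper ℓ-odd {zero}  {zero}            0≢0 _   _  = contradiction refl 0≢0
  base-proper ℓ-odd {zero}  {suc _} {zero}    _   0≢0 _  = contradiction refl 0≢0
  base-proper ℓ-odd {zero}  {suc _} {suc _}   _   _   eq = cong suc (⊕-double-injective ℓ-odd eq)
  base-proper ℓ-odd {suc _} {zero}  {zero}    _   _   _  = refl
  base-proper ℓ-odd {suc x} {zero}  {suc _}   _   x≢y eq = contradiction (cong suc (⊕-cancelˡ x eq)) x≢y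
  base-proper ℓ-odd {suc x} {suc _} {zero}    x≢y _   eq = contradiction (cong suc (⊕-cancelˡ x (sym eq))) x≢y
  base-proper ℓ-odd {suc x} {suc _} {suc _}   _   _   eq = cong suc (⊕-cancelˡ x eq)

  private
    residue : (u : Fin (suc ℓ)) → u ≢ zero → Fin ℓ
    residue u u≢0 = punchOut (u≢0 ∘ sym)

    suc-residue : ∀ u (u≢0 : u ≢ zero) → suc (residue u u≢0) ≡ u
    suc-residue u u≢0 = punchIn-punchOut (u≢0 ∘ sym)

  module _ {m} {f : Fin m → Fin (suc ℓ)} (f-inj : Injective _≡_ _≡_ f) (rainbow : Rainbow baseColouring f) where

    rainbow-finite-bound : ¬ 2 ∣ ℓ → (∀ i → f i ≢ zero) → m * (m ∸ 1) ≤ ℓ + m * 2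
    rainbow-finite-bound ℓ-odd finite = weakSidon-bound ℓ-odd {x = x} x-inj weakSidon
      where
      x : Fin m → Fin ℓ
      x i = residue (f i) (finite i)
      colour : ∀ i j → base (f i) (f j) ≡ x i ⊕ x j
      colour i j = sym (cong₂ base (suc-residue (f i) (finite i)) (suc-residue (f j) (finite j)))
      x-inj : Injective _≡_ _≡_ x
      x-inj {i} {j} eq = f-inj (trans (sym (suc-residue (f i) (finite i)))
                                      (trans (cong suc eq) (suc-residue (f j) (finite j))))
      weakSidon : WeakSidon x
      weakSidon {i} {j} {i'} {j'} i≢j i'≢j' eq =
        rainbow i≢j i'≢j' (trans (colour i j) (trans eq (sym (colour i' j'))))

  module _ {m} {f : Fin (suc m) → Fin (suc ℓ)} (f-inj : Injective _≡_ _≡_ f) (rainbow : Rainbow baseColouring f)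
           {r} (fr≡∞ : f r ≡ zero) where

    rainbow-∞-bound : m * (m ∸ 1) ≤ ℓ
    rainbow-∞-bound = sidon-bound {x = x} sidon
      where
      p : Fin m → Fin (suc m)
      p = punchIn r
      r≢p : ∀ s → r ≢ p s
      r≢p s = punchInᵢ≢i r s ∘ sym
      p-inj : Injective _≡_ _≡_ p
      p-inj = punchIn-injective r _ _
      finite : ∀ s → f (p s) ≢ zero
      finite s eq = r≢p s (f-inj (trans fr≡∞ (sym eq)))
      x : Fin m → Fin ℓ
      x s = residue (f (p s)) (finite s)
      finite-colour : ∀ s t → base (f (p s)) (f (p t)) ≡ x s ⊕ x t
      finite-colour s t = sym (cong₂ base (suc-residue _ (finite s)) (suc-residue _ (finite t)))
      ∞-colour : ∀ s → base (f r) (f (p s)) ≡ x s ⊕ x s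
      ∞-colour s = sym (cong₂ base (sym fr≡∞) (suc-residue _ (finite s)))

      -- the doubles x s ⊕ x s are coloured too, by the edges at infinity
      sidon : Sidon x
      sidon {s} {t} {s'} {t'} eq with s Fin.≟ t | s' Fin.≟ t'
      ... | yes refl | yes refl with rainbow (r≢p s) (r≢p s') (trans (∞-colour s) (trans eq (sym (∞-colour s'))))
      ...   | inj₁ (_ , ps≡ps')  = let s≡s' = p-inj ps≡ps' in inj₁ (s≡s' , s≡s')
      ...   | inj₂ (r≡ps' , _)   = contradiction r≡ps' (r≢p s')
      sidon {s} {t} {s'} {t'} eq | yes refl | no s'≢t' =
        ⊥-elim ([ r≢p s' ∘ proj₁ , r≢p t' ∘ proj₁ ]′
          (rainbow (r≢p s) (s'≢t' ∘ p-inj) (trans (∞-colour s) (trans eq (sym (finite-colour s' t'))))))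
      sidon {s} {t} {s'} {t'} eq | no s≢t | yes refl =
        ⊥-elim ([ r≢p s ∘ sym ∘ proj₁ , r≢p t ∘ sym ∘ proj₂ ]′
          (rainbow (s≢t ∘ p-inj) (r≢p s') (trans (finite-colour s t) (trans eq (sym (∞-colour s'))))))
      sidon {s} {t} {s'} {t'} eq | no s≢t | no s'≢t' =
        Sum.map (Prod.map p-inj p-inj) (Prod.map p-inj p-inj)
          (rainbow (s≢t ∘ p-inj) (s'≢t' ∘ p-inj) (trans (finite-colour s t) (trans eq (sym (finite-colour s' t')))))

  rainbowClique-base-bound : ¬ 2 ∣ ℓ → ∀ {m} → RainbowClique baseColouring m →
                             m * (m ∸ 1) ≤ ℓ + m * 2 ⊎ (m ∸ 1) * (m ∸ 2) ≤ ℓ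
  rainbowClique-base-bound ℓ-odd {zero} _ = inj₁ z≤n
  rainbowClique-base-bound ℓ-odd {suc m} R with f , f-inj , rainbow ← rainbowClique⇒rainbow {c = baseColouring} R
    with any? (λ r → f r Fin.≟ zero)
  ... | yes (r , fr≡∞) = inj₂ (rainbow-∞-bound f-inj rainbow fr≡∞)
  ... | no  no-∞       = inj₁ (rainbow-finite-bound f-inj rainbow ℓ-odd (λ i fi≡∞ → no-∞ (i , fi≡∞)))

-- 4ℓ < (2t + 3)² = 4(t + 1)(t + 2) + 1
floor-decompose : ∀ {ℓ m} → IsFloorSqrtPlus7/2 ℓ m → ∃ λ t → m ≡ 4 + t × ℓ ≤ (t + 1) * (t + 2)
floor-decompose {m = 0}                   (() , _)
floor-decompose {m = 1}                   (s≤s (s≤s ()) , _)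
floor-decompose {m = 2}                   (s≤s (s≤s (s≤s (s≤s ()))) , _)
floor-decompose {m = 3}                   (s≤s (s≤s (s≤s (s≤s (s≤s (s≤s ()))))) , _)
floor-decompose {ℓ} {suc (suc (suc (suc t)))} (_ , _ , 4ℓ<) =
  t , refl , *-cancelˡ-≤ 4 (s≤s⁻¹ (subst (4 * ℓ <_) square 4ℓ<))
  where
  square : (2 * (4 + t) ∸ 5) ^ 2 ≡ suc (4 * ((t + 1) * (t + 2)))
  square = trans (cong (λ n → (n ∸ 5) ^ 2) (double t)) (trans (cong (_^ 2) (m+n∸m≡n 5 (3 + 2 * t))) (expand t))
    where
    double : ∀ t → 2 * (4 + t) ≡ 5 + (3 + 2 * t)
    double = solve-∀
    expand : ∀ t → (3 + 2 * t) * ((3 + 2 * t) * 1) ≡ suc (4 * ((t + 1) * (t + 2)))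
    expand = solve-∀

[4+t]*[3+t]≰ℓ+[4+t]*2 : ∀ {ℓ} t → ℓ ≤ (t + 1) * (t + 2) → (4 + t) * (3 + t) ≰ ℓ + (4 + t) * 2
[4+t]*[3+t]≰ℓ+[4+t]*2 {ℓ} t ℓ≤ bound = m+1+n≰m ((t + 1) * (t + 2) + (4 + t) * 2) (begin
  (t + 1) * (t + 2) + (4 + t) * 2 + suc (2 * t + 1)  ≡⟨ expand t ⟩
  (4 + t) * (3 + t)                                  ≤⟨ bound ⟩
  ℓ + (4 + t) * 2                                    ≤⟨ +-monoˡ-≤ ((4 + t) * 2) ℓ≤ ⟩
  (t + 1) * (t + 2) + (4 + t) * 2                    ∎)
  where
  open ≤-Reasoning
  expand : ∀ t → (t + 1) * (t + 2) + (4 + t) * 2 + suc (2 * t + 1) ≡ (4 + t) * (3 + t)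
  expand = solve-∀

[3+t]*[2+t]≰ℓ : ∀ {ℓ} t → ℓ ≤ (t + 1) * (t + 2) → (3 + t) * (2 + t) ≰ ℓ
[3+t]*[2+t]≰ℓ {ℓ} t ℓ≤ bound = m+1+n≰m ((t + 1) * (t + 2)) (begin
  (t + 1) * (t + 2) + suc (2 * t + 3)  ≡⟨ expand t ⟩
  (3 + t) * (2 + t)                    ≤⟨ bound ⟩
  ℓ                                    ≤⟨ ℓ≤ ⟩
  (t + 1) * (t + 2)                    ∎)
  where
  open ≤-Reasoning
  expand : ∀ t → (t + 1) * (t + 2) + suc (2 * t + 3) ≡ (3 + t) * (2 + t)
  expand = solve-∀

¬rainbowClique-base : ∀ {ℓ m} .{{_ : NonZero ℓ}} → ¬ 2 ∣ ℓ → IsFloorSqrtPlus7/2 ℓ m →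
                      ¬ RainbowClique baseColouring m
¬rainbowClique-base {ℓ} {m} ℓ-odd floor R with t , refl , ℓ≤ ← floor-decompose {ℓ} {m} floor
  with rainbowClique-base-bound ℓ-odd R
... | inj₁ weak   = [4+t]*[3+t]≰ℓ+[4+t]*2 t ℓ≤ weak
... | inj₂ strong = [3+t]*[2+t]≰ℓ t ℓ≤ strong

theorem4 : (ℓ : ℕ) → 3 ≤ ℓ → ¬ (2 ∣ ℓ) → (m : ℕ) → IsFloorSqrtPlus7/2 ℓ m →
    (k : ℕ) → 1 ≤ k →
    Σ (EdgeColoring ((ℓ + 1) ^ k) ℓ) λ c → CompletelyBalanced c × ¬ RainbowClique c m
theorem4 ℓ@(suc _) _ ℓ-odd m floor k _ = subst Witness (+-comm 1 ℓ) (tower , balanced , rainbow-free)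
  where
  Witness : ℕ → Set
  Witness n = Σ (EdgeColoring (n ^ k) ℓ) λ c → CompletelyBalanced c × ¬ RainbowClique c m

  tower : EdgeColoring (suc ℓ ^ k) ℓ
  tower = lexPower zero baseColouring k

  balanced : CompletelyBalanced tower
  balanced = completelyBalanced-lexPower zero (proper⇒completelyBalanced baseColouring (base-proper ℓ-odd)) k

  1<m : 1 < m
  1<m with _ , m≡4+t , _ ← floor-decompose {ℓ} floor = subst (1 <_) (sym m≡4+t) (s≤s (s≤s z≤n))

  rainbow-free : ¬ RainbowClique tower m
  rainbow-free = ¬rainbowClique-lexPower zero 1<m (¬rainbowClique-base ℓ-odd floor) k
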